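{- Let $L$ be an $n\times n$ Latin square on the symbols $\{1,\dots,n\}$. If a set $D$ of cells of $L$ is a vertex cover of at least one of the graphs $R(L)$, $C(L)$, $E(L)$, then $D$ is a greedy defining set of $L$.
   Context: Write a cell of $L$ in row $i$, column $j$ with entry $x$ as $(i,j;x)$. An $n\times n$ Latin square is identified with a proper $n$-coloring of the Cartesian product $K_n\Box K_n$ (vertex $(i,j)$ gets color $L(i,j)$), with vertices ordered lexicographically: $(i,j)<(i',j')$ iff $i<i'$, or $i=i'$ and $j<j'$. A set $D$ of cells is a greedy defining set of $L$ if, pre-coloring the cells of $D$ with their entries in $L$ and then processing the remaining cells in lexicographic order, giving each the smallest positive integer not already used by a colored cell in the same row or column (cells of $D$ count as colored from the start), produces exactly $L$. A descent of $L$ is a set of three cells $(i,j;y)$, $(r,j;x)$, $(i,k;x)$ with $i<r$, $j<k$, $x<y$. For a row $R$ of $L$, $G[R]$ is the graph on the $n$ cells of $R$ in which the cell with entry $y$ and the cell with entry $x$, $x<y$, are adjacent iff $y$ appears to the left of $x$ in $R$ and the entry $x$ appears in the column of $y$ below $y$ (i.e. the two cells together with a third cell form a descent). $R(L)$ is the disjoint union of the $G[R]$ over all rows (a graph on the $n^2$ cells). For a column $C$, $G[C]$ is the graph on the $n$ cells of $C$ in which cells with entries $y$ and $x$, $x<y$, are adjacent iff $y$ lies above $x$ in $C$ and the entry $x$ appears in the row of $y$ to the right of $y$; $C(L)$ is the disjoint union of the $G[C]$. For a symbol $e$, $G[e]$ is the graph on the $n$ cells containing $e$ in which two such cells are adjacent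 iff together with some third cell they form a descent of $L$; $E(L)$ is the disjoint union of $G[1],\dots,G[n]$. -}

module Defs where

open import Data.Nat using (ℕ; zero; suc; _≤_; _<_)
import Data.Nat as N
open import Data.Fin as F using (Fin)
import Data.Fin.Properties as FP
open import Data.Bool using (Bool; true; false; if_then_else_; T)
open import Data.List using (List; []; _∷_; length; map; concatMap; foldl; mapMaybe; allFin)
open import Data.List.Relation.Unary.Any using (any?)
open import Data.List.Base using (filter)
open import Data.Maybe using (Maybe; just; nothing)
open import Data.Product using (Σ; ∃; _×_; _,_; proj₁; proj₂)
open import Data.Product.Properties using (≡-dec)
open import Data.Sum using (_⊎_)
open import Relation.Nullary using (¬_; Dec; yes; no)
open import Relation.Nullary.Decidable using (_⊎-dec_; _×-dec_; ¬?; ⌊_⌋)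
open import Relation.Binary.PropositionalEquality using (_≡_; _≢_)

-- A cell (i , j): row i, column j.  Rows/columns indexed by Fin n.
Cell : ℕ → Set
Cell n = Fin n × Fin n

Square : ℕ → Set
Square n = Fin n → Fin n → ℕ

entry : ∀ {n} → Square n → Cell n → ℕ
entry L (i , j) = L i j

record IsLatin {n : ℕ} (L : Square n) : Set where
  field
    range   : ∀ i j → 1 ≤ L i j × L i j ≤ n
    rowInj  : ∀ i j k → L i j ≡ L i k → j ≡ k
    colInj  : ∀ i r j → L i j ≡ L r j → i ≡ r

CellSet : ℕ → Set
CellSet n = Cell n → Bool

_∈D_ : ∀ {n} → Cell n → CellSet n → Set
c ∈D D = T (D c)

_≟c_ : ∀ {n} (c d : Cell n) → Dec (c ≡ d)
_≟c_ = ≡-dec F._≟_ F._≟_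

mexFrom : ℕ → ℕ → List ℕ → ℕ
mexFrom zero    k xs = k
mexFrom (suc f) k xs with any? (N._≟_ k) xs
... | yes _ = mexFrom f (suc k) xs
... | no  _ = k

-- smallest positive integer not in xs (fuel length xs suffices)
smallestFree : List ℕ → ℕ
smallestFree xs = mexFrom (length xs) 1 xs

cellsLex : (n : ℕ) → List (Cell n)
cellsLex n = concatMap (λ i → map (λ j → (i , j)) (allFin n)) (allFin n)

PColouring : ℕ → Set
PColouring n = Cell n → Maybe ℕ

adjacent? : ∀ {n} (c d : Cell n) → Dec ((proj₁ c ≡ proj₁ d ⊎ proj₂ c ≡ proj₂ d) × ¬ (c ≡ d))
adjacent? (i , j) (r , k) = ((i F.≟ r) ⊎-dec (j F.≟ k)) ×-dec ¬? ((i , j) ≟c (r , k))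

usedColours : ∀ {n} → PColouring n → Cell n → List ℕ
usedColours {n} f c = mapMaybe f (filter (adjacent? c) (cellsLex n))

initial : ∀ {n} → Square n → CellSet n → PColouring n
initial L D c = if D c then just (entry L c) else nothing

step : ∀ {n} → CellSet n → PColouring n → Cell n → PColouring n
step D f c with D c
... | true  = f
... | false = λ d → if ⌊ d ≟c c ⌋ then just (smallestFree (usedColours f c)) else f d

greedy : ∀ {n} → Square n → CellSet n → PColouring n
greedy {n} L D = foldl (step D) (initial L D) (cellsLex n)

IsGreedyDefiningSet : ∀ {n} → Square n → CellSet n → Set
IsGreedyDefiningSet {n} L D = ∀ (c : Cell n) → greedy L D c ≡ just (entry L c)

-- Descents: cells (i,j;y), (r,j;x), (i,k;x) with i<r, j<k, x<y

record Descent {n : ℕ} (L : Square n) : Set where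
  constructor descent
  field
    i r j k : Fin n
    i<r : i F.< r
    j<k : j F.< k
    sameX : L r j ≡ L i k
    x<y : L i k < L i j

_∈Desc_ : ∀ {n} {L : Square n} → Cell n → Descent L → Set
c ∈Desc d = c ≡ (i , j) ⊎ c ≡ (r , j) ⊎ c ≡ (i , k)
  where open Descent d

REdge : ∀ {n} → Square n → Cell n → Cell n → Set
REdge L (i , j) (i' , k) =
  i ≡ i' × j F.< k × L i k < L i j × ∃ λ r → i F.< r × L r j ≡ L i k

CEdge : ∀ {n} → Square n → Cell n → Cell n → Set
CEdge L (i , j) (r , j') =
  j ≡ j' × i F.< r × L r j < L i j × ∃ λ k → j F.< k × L i k ≡ L r j

EEdge : ∀ {n} → Square n → Cell n → Cell n → Set
EEdge L c c' =
  c ≢ c' × entry L c ≡ entry L c' ×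
  Σ (Descent L) λ d → c ∈Desc d × c' ∈Desc d

-- D is a vertex cover of the graph on cells with edge relation E
-- (edges are read as unordered pairs; the condition is symmetric).
VertexCover : ∀ {n} → (Cell n → Cell n → Set) → CellSet n → Set
VertexCover {n} E D = ∀ (c c' : Cell n) → E c c' → c ∈D D ⊎ c' ∈D D

module Submission where

-- The greedy algorithm colours a cell c ∉ D with the least positive integer
-- missing from the colours already present in its row and column.  It
-- reproduces L exactly when, inductively, every symbol 1 ≤ x < L(c) is
-- already present next to c, i.e. sits in the row or column of c in a cell
-- that is lexicographically earlier or belongs to D (the "greedy
-- condition"); the entry L(c) itself never appears there, L being Latin.
--
-- Such an x occurs in the row of c = (i,j) at some (i,k) and in its column
-- at some (r,j).  If k < j or r < i one of them is earlier; otherwise the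
-- three cells (i,j;y), (r,j;x), (i,k;x) form a descent.  So the greedy
-- condition follows from the "descent condition": every descent whose
-- corner (i,j) lies outside D has another of its cells in D.  Finally each
-- of the three vertex-cover hypotheses gives the descent condition, since
-- in every descent one edge of each graph R(L), C(L), E(L) joins two of
-- its cells.

open import Defs
open import Data.Nat using (ℕ; zero; suc; _≤_; _<_; _+_; z≤n; s≤s)
import Data.Nat as N
import Data.Nat.Properties as NP
open import Data.Fin as F using (Fin)
import Data.Fin.Properties as FP
open import Data.Bool using (true; false; if_then_else_; T)
open import Data.Unit using (tt)
open import Data.List using (List; []; _∷_; length; map; mapMaybe; foldl; allFin; lookup)
open import Data.List.Membership.Propositional using (_∈_; _∉_)
open import Data.List.Membership.Propositional.Properties
  using (∈-filter⁺; ∈-map⁺; ∈-allFin; ∈-concat⁺′)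
open import Data.List.Relation.Unary.Any as Any using (Any; here; there; any?)
import Data.List.Relation.Unary.Any.Properties as AnyP
open import Data.List.Relation.Unary.All as All using (All)
import Data.List.Relation.Unary.All.Properties as AllP
open import Data.List.Relation.Unary.AllPairs using (AllPairs; _∷_)
import Data.List.Relation.Unary.AllPairs.Properties as AllPairsP
open import Data.Maybe using (Maybe; just; nothing)
import Data.Maybe.Relation.Unary.All as MAll
import Data.Maybe.Relation.Unary.Any as MAny
open import Data.Product using (Σ; ∃; _×_; _,_; proj₁; proj₂)
open import Data.Sum using (_⊎_; inj₁; inj₂)
open import Data.Empty using (⊥-elim)
open import Relation.Nullary using (¬_; yes; no)
open import Relation.Nullary.Decidable using (⌊_⌋)
open import Relation.Binary.PropositionalEquality
  using (_≡_; _≢_; refl; sym; trans; cong; subst)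
open import Relation.Binary.Definitions using (tri<; tri≈; tri>)

∈-mapMaybe⁺ : ∀ {A B : Set} (g : A → Maybe B) {xs : List A} {a : A} {x : B} →
              a ∈ xs → g a ≡ just x → x ∈ mapMaybe g xs
∈-mapMaybe⁺ g {xs} {x = x} a∈xs ga≡x =
  AnyP.mapMaybe⁺ g xs (AnyP.map⁺ (Any.map witness a∈xs))
  where
  witness : ∀ {a} → _ ≡ a → MAny.Any (x ≡_) (g a)
  witness refl = subst (MAny.Any (x ≡_)) (sym ga≡x) (MAny.just refl)

length-≥-if-contains-1…m : (m : ℕ) (xs : List ℕ) →
  (∀ x → 1 ≤ x → x ≤ m → x ∈ xs) → m ≤ length xs
length-≥-if-contains-1…m m xs contains = FP.injective⇒≤ {f = position} injective
  where
  occurs : (k : Fin m) → suc (F.toℕ k) ∈ xs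
  occurs k = contains (suc (F.toℕ k)) (s≤s z≤n) (FP.toℕ<n k)
  position : Fin m → Fin (length xs)
  position k = Any.index (occurs k)
  injective : ∀ {a b} → position a ≡ position b → a ≡ b
  injective {a} {b} same = FP.toℕ-injective (NP.suc-injective
    (trans (AnyP.lookup-index (occurs a))
      (trans (cong (lookup xs) same) (sym (AnyP.lookup-index (occurs b))))))

mexFrom-finds : ∀ fuel k y (xs : List ℕ) → k ≤ y → (∀ x → k ≤ x → x < y → x ∈ xs) →
                y ∉ xs → y ≤ fuel + k → mexFrom fuel k xs ≡ y
mexFrom-finds zero k y xs k≤y below y∉xs y≤k = NP.≤-antisym k≤y y≤k
mexFrom-finds (suc fuel) k y xs k≤y below y∉xs y≤ with any? (N._≟_ k) xs
  | NP.m≤n⇒m<n∨m≡n k≤y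
... | yes k∈xs | inj₂ refl = ⊥-elim (y∉xs k∈xs)
... | yes _    | inj₁ k<y  =
  mexFrom-finds fuel (suc k) y xs k<y
    (λ x k<x x<y → below x (NP.<⇒≤ k<x) x<y) y∉xs
    (subst (y ≤_) (sym (NP.+-suc fuel k)) y≤)
... | no _     | inj₂ k≡y  = k≡y
... | no k∉xs  | inj₁ k<y  = ⊥-elim (k∉xs (below k NP.≤-refl k<y))

-- smallestFree xs is y whenever 1, …, y-1 ∈ xs and y ∉ xs (y ≥ 1); the
-- pigeonhole bound shows that the fuel length xs is enough.
smallestFree-is : ∀ y (xs : List ℕ) → 1 ≤ y → (∀ x → 1 ≤ x → x < y → x ∈ xs) →
                  y ∉ xs → smallestFree xs ≡ y
smallestFree-is (suc y) xs 1≤y below y∉xs =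
  mexFrom-finds (length xs) 1 (suc y) xs 1≤y below y∉xs
    (subst (suc y ≤_) (NP.+-comm 1 (length xs))
      (s≤s (length-≥-if-contains-1…m y xs (λ x 1≤x x≤y → below x 1≤x (s≤s x≤y)))))

-- An injective map Fin n → {1, …, n} attains every value in {1, …, n}:
-- otherwise, shifted down by one and with the missing value punched out,
-- it would be an injection Fin n → Fin (n - 1).
injective-into-1…n-surjective : ∀ n (g : Fin n → ℕ) → (∀ k → 1 ≤ g k × g k ≤ n) →
  (∀ a b → g a ≡ g b → a ≡ b) → ∀ x → 1 ≤ x → x ≤ n → ∃ λ k → g k ≡ x
injective-into-1…n-surjective n g range injective x 1≤x x≤n
  with FP.any? (λ k → g k N.≟ x)
... | yes hit = hit
injective-into-1…n-surjective zero g range injective x 1≤x x≤n | no _ =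
  ⊥-elim (NP.<-irrefl refl (NP.≤-trans 1≤x x≤n))
injective-into-1…n-surjective (suc m) g range injective x 1≤x x≤n | no miss =
  ⊥-elim (NP.<-irrefl refl (FP.injective⇒≤ {f = squeezed} squeezed-injective))
  where
  shift : ∀ {a} → 1 ≤ a → a ≤ suc m → Fin (suc m)
  shift {suc a} _ (s≤s a≤m) = F.fromℕ< (s≤s a≤m)
  shift-injective : ∀ {a b} (1≤a : 1 ≤ a) a≤ (1≤b : 1 ≤ b) b≤ →
                    shift 1≤a a≤ ≡ shift 1≤b b≤ → a ≡ b
  shift-injective {suc a} {suc b} _ (s≤s a≤m) _ (s≤s b≤m) same =
    cong suc (trans (sym (FP.toℕ-fromℕ< (s≤s a≤m)))
               (trans (cong F.toℕ same) (FP.toℕ-fromℕ< (s≤s b≤m))))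
  shifted : Fin (suc m) → Fin (suc m)
  shifted k = shift (proj₁ (range k)) (proj₂ (range k))
  missed : ∀ k → shift 1≤x x≤n ≢ shifted k
  missed k same = miss (k , sym (shift-injective 1≤x x≤n _ _ same))
  squeezed : Fin (suc m) → Fin m
  squeezed k = F.punchOut (missed k)
  squeezed-injective : ∀ {a b} → squeezed a ≡ squeezed b → a ≡ b
  squeezed-injective {a} {b} same = injective a b
    (shift-injective _ _ _ _ (FP.punchOut-injective (missed a) (missed b) same))

module LatinProperties {n : ℕ} {L : Square n} (latin : IsLatin L) where
  open IsLatin latin

  symbol-in-row : ∀ i x → 1 ≤ x → x ≤ n → ∃ λ k → L i k ≡ x
  symbol-in-row i = injective-into-1…n-surjective n (L i) (range i) (rowInj i)

  symbol-in-column : ∀ j x → 1 ≤ x → x ≤ n → ∃ λ r → L r j ≡ x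
  symbol-in-column j = injective-into-1…n-surjective n (λ r → L r j)
    (λ r → range r j) (λ a b → colInj a b j)

  Adjacent : Cell n → Cell n → Set
  Adjacent c d = (proj₁ c ≡ proj₁ d ⊎ proj₂ c ≡ proj₂ d) × ¬ (c ≡ d)

  adjacent-distinct : ∀ c d → Adjacent c d → entry L c ≢ entry L d
  adjacent-distinct (i , j) (r , k) (inj₁ refl , c≢d) same =
    c≢d (cong (i ,_) (rowInj i j k same))
  adjacent-distinct (i , j) (r , k) (inj₂ refl , c≢d) same =
    c≢d (cong (_, j) (colInj i r j same))

_<ₗ_ : ∀ {n} → Cell n → Cell n → Set
(i , j) <ₗ (i' , j') = i F.< i' ⊎ (i ≡ i' × j F.< j')

<ₗ-irrefl : ∀ {n} (c : Cell n) → ¬ (c <ₗ c)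
<ₗ-irrefl _ (inj₁ i<i)       = FP.<-irrefl refl i<i
<ₗ-irrefl _ (inj₂ (_ , j<j)) = FP.<-irrefl refl j<j

<ₗ-asym : ∀ {n} (c d : Cell n) → c <ₗ d → ¬ (d <ₗ c)
<ₗ-asym _ _ (inj₁ i<r)          (inj₁ r<i)          = FP.<-asym i<r r<i
<ₗ-asym _ _ (inj₁ i<i)          (inj₂ (refl , _))   = FP.<-irrefl refl i<i
<ₗ-asym _ _ (inj₂ (refl , _))   (inj₁ i<i)          = FP.<-irrefl refl i<i
<ₗ-asym _ _ (inj₂ (refl , j<k)) (inj₂ (_ , k<j))    = FP.<-asym j<k k<j

cellsLex-sorted : ∀ n → AllPairs _<ₗ_ (cellsLex n)
cellsLex-sorted n = AllPairsP.concat⁺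
  (AllP.map⁺ (AllP.tabulate⁺ λ i →
    AllPairsP.map⁺ (AllPairsP.tabulate⁺-< λ j<k → inj₂ (refl , j<k))))
  (AllPairsP.map⁺ (AllPairsP.tabulate⁺-< λ i<r →
    AllP.map⁺ (AllP.tabulate⁺ λ _ → AllP.map⁺ (AllP.tabulate⁺ λ _ → inj₁ i<r))))

∈-cellsLex : ∀ {n} (c : Cell n) → c ∈ cellsLex n
∈-cellsLex {n} (i , j) = ∈-concat⁺′ (∈-map⁺ (i ,_) (∈-allFin j))
  (∈-map⁺ (λ i → map (i ,_) (allFin n)) (∈-allFin i))

module Greedy {n : ℕ} (L : Square n) (latin : IsLatin L) (D : CellSet n) where
  open IsLatin latin
  open LatinProperties latin

  GreedyCondition : Set
  GreedyCondition = ∀ c → D c ≡ false → ∀ x → 1 ≤ x → x < entry L c →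
    Σ (Cell n) λ d → Adjacent c d × entry L d ≡ x × (d <ₗ c ⊎ T (D d))

  record Invariant (done : List (Cell n)) (f : PColouring n) : Set where
    field
      sound  : ∀ d → MAll.All (_≡ entry L d) (f d)
      onD    : ∀ d → T (D d) → f d ≡ just (entry L d)
      onDone : ∀ d → d ∈ done → f d ≡ just (entry L d)

  initial-invariant : Invariant [] (initial L D)
  initial-invariant = record { sound = sound ; onD = onD ; onDone = λ _ () }
    where
    sound : ∀ d → MAll.All (_≡ entry L d) (initial L D d)
    sound d with D d
    ... | true  = MAll.just refl
    ... | false = MAll.nothing
    onD : ∀ d → T (D d) → initial L D d ≡ just (entry L d)
    onD d _ with D d
    ... | true = refl

  -- Once every earlier cell is coloured, the greedy colour of c ∉ D is L(c):
  -- the smaller symbols are all used next to c, and L(c) is not.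
  greedy-colour : GreedyCondition → ∀ {done f} c → Invariant done f →
    (∀ d → d <ₗ c → d ∈ done) → D c ≡ false →
    smallestFree (usedColours f c) ≡ entry L c
  greedy-colour condition {f = f} c inv earlier c∉D =
    smallestFree-is (entry L c) (usedColours f c)
      (proj₁ (range (proj₁ c) (proj₂ c))) smaller-used entry-unused
    where
    open Invariant inv
    smaller-used : ∀ x → 1 ≤ x → x < entry L c → x ∈ usedColours f c
    smaller-used x 1≤x x<Lc with condition c c∉D x 1≤x x<Lc
    ... | d , c~d , Ld≡x , placed =
      ∈-mapMaybe⁺ f (∈-filter⁺ (adjacent? c) (∈-cellsLex d) c~d)
        (trans (coloured placed) (cong just Ld≡x))
      where
      coloured : d <ₗ c ⊎ T (D d) → f d ≡ just (entry L d)
      coloured (inj₁ d<c)  = onDone d (earlier d d<c)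
      coloured (inj₂ d∈D) = onD d d∈D
    entry-unused : entry L c ∉ usedColours f c
    entry-unused = AllP.All¬⇒¬Any (AllP.mapMaybe⁺ (AllP.map⁺
      (All.map (λ {d} c~d → MAll.map (λ f≡Ld Lc≡f →
          adjacent-distinct c d c~d (trans Lc≡f f≡Ld)) (sound d))
        (AllP.all-filter (adjacent? c) (cellsLex n)))))

  step-invariant : GreedyCondition → ∀ {done f} c → Invariant done f →
    (∀ d → d <ₗ c → d ∈ done) → Invariant (c ∷ done) (step D f c)
  step-invariant condition {done} {f} c inv earlier with D c in D[c]
  ... | true = record { sound = sound ; onD = onD ; onDone = onDone′ }
    where
    open Invariant inv
    onDone′ : ∀ d → d ∈ c ∷ done → f d ≡ just (entry L d)
    onDone′ d (here refl) = onD c (subst T (sym D[c]) tt)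
    onDone′ d (there d∈done) = onDone d d∈done
  ... | false = record
    { sound  = sound′
    ; onD    = λ d d∈D → updated d (λ _ → onD d d∈D)
    ; onDone = λ d d∈ → updated d (previously d d∈)
    }
    where
    open Invariant inv
    colour : ℕ
    colour = smallestFree (usedColours f c)
    colour≡ : colour ≡ entry L c
    colour≡ = greedy-colour condition c inv earlier D[c]
    sound′ : ∀ d → MAll.All (_≡ entry L d) (if ⌊ d ≟c c ⌋ then just colour else f d)
    sound′ d with d ≟c c
    ... | yes refl = MAll.just colour≡
    ... | no _     = sound d
    updated : ∀ d → (d ≢ c → f d ≡ just (entry L d)) →
              (if ⌊ d ≟c c ⌋ then just colour else f d) ≡ just (entry L d)
    updated d before with d ≟c c
    ... | yes refl = cong just colour≡
    ... | no d≢c   = before d≢c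
    previously : ∀ d → d ∈ c ∷ done → d ≢ c → f d ≡ just (entry L d)
    previously d (here refl) d≢c = ⊥-elim (d≢c refl)
    previously d (there d∈done) _ = onDone d d∈done

  run-correct : GreedyCondition → ∀ done rest f → Invariant done f →
    AllPairs _<ₗ_ rest → (∀ d → d ∈ done ⊎ d ∈ rest) →
    ∀ d → foldl (step D) f rest d ≡ just (entry L d)
  run-correct condition done [] f inv _ covered d with covered d
  ... | inj₁ d∈done = Invariant.onDone inv d d∈done
  run-correct condition done (c ∷ rest) f inv (c<rest ∷ sorted) covered =
    run-correct condition (c ∷ done) rest (step D f c)
      (step-invariant condition c inv earlier) sorted covered′
    where
    earlier : ∀ d → d <ₗ c → d ∈ done
    earlier d d<c with covered d
    ... | inj₁ d∈done         = d∈done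
    ... | inj₂ (here refl)    = ⊥-elim (<ₗ-irrefl c d<c)
    ... | inj₂ (there d∈rest) = ⊥-elim (<ₗ-asym c d (All.lookup c<rest d∈rest) d<c)
    covered′ : ∀ d → d ∈ c ∷ done ⊎ d ∈ rest
    covered′ d with covered d
    ... | inj₁ d∈done         = inj₁ (there d∈done)
    ... | inj₂ (here refl)    = inj₁ (here refl)
    ... | inj₂ (there d∈rest) = inj₂ d∈rest

  greedy-correct : GreedyCondition → IsGreedyDefiningSet L D
  greedy-correct condition = run-correct condition [] (cellsLex n) (initial L D)
    initial-invariant (cellsLex-sorted n) (λ d → inj₂ (∈-cellsLex d))

module Descents {n : ℕ} (L : Square n) (latin : IsLatin L) (D : CellSet n) where
  open IsLatin latin
  open LatinProperties latin
  open Greedy L latin D using (GreedyCondition)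

  DescentCondition : Set
  DescentCondition = (δ : Descent L) → let open Descent δ in
    D (i , j) ≡ false → T (D (i , k)) ⊎ T (D (r , j))

  row-adjacent : ∀ i {j k : Fin n} → j ≢ k → Adjacent (i , j) (i , k)
  row-adjacent i j≢k = inj₁ refl , λ same → j≢k (cong proj₂ same)

  column-adjacent : ∀ j {i r : Fin n} → i ≢ r → Adjacent (i , j) (r , j)
  column-adjacent j i≢r = inj₂ refl , λ same → i≢r (cong proj₁ same)

  <⇒≢ : {a b : Fin n} → a F.< b → a ≢ b
  <⇒≢ a<b refl = FP.<-irrefl refl a<b

  -- Symbol x < L(i,j) occurs at (i,k) and (r,j): either one of these is
  -- earlier than (i,j), or they form a descent with it.
  descent⇒greedy : DescentCondition → GreedyCondition
  descent⇒greedy condition (i , j) c∉D x 1≤x x<y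
    with symbol-in-row i x 1≤x x≤n | symbol-in-column j x 1≤x x≤n
    where x≤n = NP.≤-trans (NP.<⇒≤ x<y) (proj₂ (range i j))
  ... | k , Lik≡x | r , Lrj≡x with FP.<-cmp k j | FP.<-cmp r i
  ... | tri≈ _ refl _ | _ = ⊥-elim (NP.<-irrefl (sym Lik≡x) x<y)
  ... | _ | tri≈ _ refl _ = ⊥-elim (NP.<-irrefl (sym Lrj≡x) x<y)
  ... | tri< k<j _ _ | _ =
    (i , k) , row-adjacent i (λ e → <⇒≢ k<j (sym e)) , Lik≡x , inj₁ (inj₂ (refl , k<j))
  ... | tri> _ _ j<k | tri< r<i _ _ =
    (r , j) , column-adjacent j (λ e → <⇒≢ r<i (sym e)) , Lrj≡x , inj₁ (inj₁ r<i)
  ... | tri> _ _ j<k | tri> _ _ i<r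
    with condition (descent i r j k i<r j<k (trans Lrj≡x (sym Lik≡x))
                     (subst (_< L i j) (sym Lik≡x) x<y)) c∉D
  ...   | inj₁ ik∈D = (i , k) , row-adjacent i (<⇒≢ j<k) , Lik≡x , inj₂ ik∈D
  ...   | inj₂ rj∈D = (r , j) , column-adjacent j (<⇒≢ i<r) , Lrj≡x , inj₂ rj∈D

  false⇒∉ : ∀ c → D c ≡ false → ¬ T (D c)
  false⇒∉ c D[c] c∈D = subst T D[c] c∈D

  -- In a descent, (i,j;y)–(i,k;x) is an edge of R(L).
  R-cover⇒descent : VertexCover (REdge L) D → DescentCondition
  R-cover⇒descent cover (descent i r j k i<r j<k same x<y) ij∉D
    with cover (i , j) (i , k) (refl , j<k , x<y , r , i<r , same)
  ... | inj₁ ij∈D = ⊥-elim (false⇒∉ (i , j) ij∉D ij∈D)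
  ... | inj₂ ik∈D = inj₁ ik∈D

  -- In a descent, (i,j;y)–(r,j;x) is an edge of C(L).
  C-cover⇒descent : VertexCover (CEdge L) D → DescentCondition
  C-cover⇒descent cover (descent i r j k i<r j<k same x<y) ij∉D
    with cover (i , j) (r , j)
           (refl , i<r , subst (_< L i j) (sym same) x<y , k , j<k , sym same)
  ... | inj₁ ij∈D = ⊥-elim (false⇒∉ (i , j) ij∉D ij∈D)
  ... | inj₂ rj∈D = inj₂ rj∈D

  -- In a descent, (r,j;x)–(i,k;x) is an edge of E(L).
  E-cover⇒descent : VertexCover (EEdge L) D → DescentCondition
  E-cover⇒descent cover δ@(descent i r j k i<r j<k same x<y) _
    with cover (r , j) (i , k)
           ((λ e → <⇒≢ i<r (sym (cong proj₁ e))) , same ,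
            δ , inj₂ (inj₁ refl) , inj₂ (inj₂ refl))
  ... | inj₁ rj∈D = inj₂ rj∈D
  ... | inj₂ ik∈D = inj₁ ik∈D

proposition1 : (n : ℕ) (L : Square n) → IsLatin L → (D : CellSet n) →
    VertexCover (REdge L) D ⊎ VertexCover (CEdge L) D ⊎ VertexCover (EEdge L) D →
    IsGreedyDefiningSet L D
proposition1 n L latin D cover =
  greedy-correct (descent⇒greedy (descent-condition cover))
  where
  open Greedy L latin D using (greedy-correct)
  open Descents L latin D
  descent-condition : VertexCover (REdge L) D ⊎ VertexCover (CEdge L) D ⊎
                      VertexCover (EEdge L) D → DescentCondition
  descent-condition (inj₁ R-cover)        = R-cover⇒descent R-cover
  descent-condition (inj₂ (inj₁ C-cover)) = C-cover⇒descent C-cover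
  descent-condition (inj₂ (inj₂ E-cover)) = E-cover⇒descent E-cover
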